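{- For every matroid $M$ and all $X,Y\subseteq E(M)$, $\kappa(X)+\kappa(Y)\ge\kappa(X\cup Y)+\kappa(X\cap Y)$.
   Context: Matroids may be infinite. A matroid is a pair $M=(E,\mathcal I)$ with $\mathcal I$ a set of subsets of $E$ (the independent sets) such that: (I1) $\emptyset\in\mathcal I$; (I2) $\mathcal I$ is closed under subsets; (I3) for every $I\in\mathcal I$ that is not $\subseteq$-maximal in $\mathcal I$ and every $\subseteq$-maximal $I'\in\mathcal I$ there is $x\in I'\setminus I$ with $I\cup\{x\}\in\mathcal I$; (IM) whenever $I\subseteq X\subseteq E$ and $I\in\mathcal I$, the set $\{I'\in\mathcal I: I\subseteq I'\subseteq X\}$ has a maximal element. For independent $I,J$, $\mathrm{del}(I,J)$ is the minimum of $|F|$ over $F\subseteq I\cup J$ with $(I\cup J)\setminus F$ independent (or $\infty$). $\kappa(X)=\kappa_M(X):=\mathrm{del}(B,B')$ for any basis $B$ of $M|X$ and any basis $B'$ of $M|(E\setminus X)$ (independent of the choice); values lie in $\{0,1,2,\dots\}\cup\{\infty\}$. -}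

module Defs where

open import Level using (0ℓ)
open import Data.Nat using (ℕ; _<_) renaming (_+_ to _+ℕ_; _≤_ to _≤ℕ_)
open import Data.Empty using (⊥)
open import Data.Unit using (⊤)
open import Data.Product using (Σ; ∃; _×_)
open import Data.List using (List; length)
open import Data.List.Relation.Unary.All using (All)
open import Data.List.Relation.Unary.Unique.Propositional using (Unique)
open import Data.List.Membership.Propositional using () renaming (_∈_ to _∈L_)
open import Relation.Nullary using (¬_)
open import Relation.Unary using (Pred; _∈_; _∉_; _⊆_; _∪_; _∩_; ∁; ∅; ｛_｝)
open import Relation.Binary.PropositionalEquality using (_≡_)

Subset : Set → Set₁
Subset E = Pred E 0ℓ

Maximal : {E : Set} → (Subset E → Set) → Subset E → Set₁
Maximal {E} P A = P A × ((B : Subset E) → P B → A ⊆ B → B ⊆ A)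

record Matroid (E : Set) : Set₁ where
  field
    Ind : Subset E → Set
    I1  : Ind ∅
    I2  : (I J : Subset E) → Ind J → I ⊆ J → Ind I
    I3  : (I I′ : Subset E) → Ind I → ¬ Maximal Ind I → Maximal Ind I′ →
          ∃ λ (x : E) → x ∈ I′ × x ∉ I × Ind (I ∪ ｛ x ｝)
    IM  : (I X : Subset E) → Ind I → I ⊆ X →
          Σ (Subset E) λ J → Maximal (λ J′ → Ind J′ × I ⊆ J′ × J′ ⊆ X) J

open Matroid public

data ℕ∞ : Set where
  fin : ℕ → ℕ∞
  ∞   : ℕ∞

_+∞_ : ℕ∞ → ℕ∞ → ℕ∞
fin m +∞ fin n = fin (m +ℕ n)
fin m +∞ ∞     = ∞
∞     +∞ _     = ∞

_≤∞_ : ℕ∞ → ℕ∞ → Set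
fin m ≤∞ fin n = m ≤ℕ n
fin m ≤∞ ∞     = ⊤
∞     ≤∞ fin n = ⊥
∞     ≤∞ ∞     = ⊤

module _ {E : Set} (M : Matroid E) where

  DelWitness : Subset E → Subset E → ℕ → Set
  DelWitness I J n =
    Σ (List E) λ F → length F ≡ n × Unique F × All (λ e → e ∈ (I ∪ J)) F ×
      Ind M (λ e → (e ∈ (I ∪ J)) × ¬ (e ∈L F))

  -- del(I,J) = v : v is the minimum of |F| over such F (∞ if no finite F works;
  -- infinite F have |F| = ∞ and so never lower the minimum).
  DelIs : Subset E → Subset E → ℕ∞ → Set
  DelIs I J (fin n) = DelWitness I J n × ((m : ℕ) → m < n → ¬ DelWitness I J m)
  DelIs I J ∞       = (m : ℕ) → ¬ DelWitness I J m

  IsBasisOf : Subset E → Subset E → Set₁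
  IsBasisOf X B = Maximal (λ B′ → Ind M B′ × B′ ⊆ X) B

  -- κ_M(X) = v : del(B,B′) = v for (any, equivalently every) basis B of M|X
  -- and basis B′ of M|(E \ X).
  KappaIs : Subset E → ℕ∞ → Set₁
  KappaIs X v = (B B′ : Subset E) → IsBasisOf X B → IsBasisOf (∁ X) B′ → DelIs B B′ v

-- Fix a base K of M and, for each Z, bases of M|Z and M|∁Z extending K ∩ Z and K ∖ Z.
-- Deleting the excess of their union over K leaves a subset of K, so κ(Z) is at most the size
-- of that excess; conversely, a base-exchange count shows that independent I ⊆ Z and I′ ⊆ ∁Z
-- satisfy |(I ∪ I′) ∖ K| ≤ κ(Z) + |K ∖ (I ∪ I′)|.  For submodularity take finite parts J₁, J₂ of
-- the excess of the bases of X ∪ Y and X ∩ Y, and a maximal independent W with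
-- (K ∩ X ∩ Y) ∪ J₂ ⊆ W ⊆ (K ∩ (X ∪ Y)) ∪ J₁ ∪ J₂.  By augmentation W misses only finitely many
-- elements of (K ∩ (X ∪ Y)) ∪ J₁, and counting shows that W ∩ X and W ∩ Y exceed K by at least
-- |J₁| + |J₂| more than they fall short of it.  The same on the complements, combined with the
-- bound above for X and for Y, shows that the two excesses have at most κ(X) + κ(Y) elements.

module Submission where

open import Defs
open import Axiom.ExcludedMiddle using (ExcludedMiddle)
open import Axiom.DoubleNegationElimination using (em⇒dne)
open import Data.Empty using (⊥-elim)
open import Data.Unit using (tt)
open import Data.Nat using (ℕ; zero; suc; _+_; _≤_; z≤n; s≤s)
open import Data.Nat.Properties
open import Data.Nat.Solver using (module +-*-Solver)
open import Algebra.Properties.CommutativeSemigroup +-commutativeSemigroup using (interchange)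
open import Data.Product using (Σ; _×_; _,_; proj₁; proj₂)
open import Data.Sum using (_⊎_; inj₁; inj₂; [_,_])
open import Data.List using (List; []; _∷_; length; filter; _++_)
open import Data.List.Properties using (length-++; filter-notAll; filter-accept; filter-reject; filter-none; filter-all)
open import Data.List.Relation.Unary.All as All using (All; []; _∷_)
import Data.List.Relation.Unary.All.Properties as All
open import Data.List.Relation.Unary.Any as Any using (here; there)
open import Data.List.Relation.Unary.AllPairs using ([]; _∷_)
open import Data.List.Relation.Unary.Unique.Propositional using (Unique)
import Data.List.Relation.Unary.Unique.Propositional.Properties as Unique
open import Data.List.Membership.Propositional using () renaming (_∈_ to _∈L_; _∉_ to _∉L_)
open import Data.List.Membership.Propositional.Properties using (∈-filter⁺; ∈-filter⁻; ∈-++⁺ˡ; ∈-++⁺ʳ; ∈-++⁻)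
open import Function using (_∘_; case_of_)
open import Relation.Nullary using (¬_; yes; no; contradiction)
open import Relation.Unary using (Decidable; _∈_; _∉_; _⊆_; _∪_; _∩_; _∖_; ∁; ｛_｝; U)
open import Relation.Binary.PropositionalEquality using (_≡_; _≢_; refl; sym; trans; cong; cong₂; subst; module ≡-Reasoning)

≤∞-∞ : ∀ v → v ≤∞ ∞
≤∞-∞ (fin _) = tt
≤∞-∞ ∞ = tt

+∞-≤-fin : ∀ {c d p q n} → c ≤∞ fin p → d ≤∞ fin q → p + q ≤ n → (c +∞ d) ≤∞ fin n
+∞-≤-fin {fin _} {fin _} c≤p d≤q p+q≤n = ≤-trans (+-mono-≤ c≤p d≤q) p+q≤n

module Counting (em : ∀ {ℓ} → ExcludedMiddle ℓ) {E : Set} where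

  dne : {P : Set} → ¬ ¬ P → P
  dne = em⇒dne em

  dec : (P : Subset E) → Decidable P
  dec P _ = em

  ∁∩⊆∁∪∁ : ∀ {X Y : Subset E} → ∁ (X ∩ Y) ⊆ ∁ X ∪ ∁ Y
  ∁∩⊆∁∪∁ {X} {x = e} e∉X∩Y with em {P = e ∈ X}
  ... | yes e∈X = inj₂ (λ e∈Y → e∉X∩Y (e∈X , e∈Y))
  ... | no e∉X = inj₁ e∉X

  ∁∪∁⊆∁∩ : ∀ {X Y : Subset E} → ∁ X ∪ ∁ Y ⊆ ∁ (X ∩ Y)
  ∁∪∁⊆∁∩ (inj₁ e∉X) (e∈X , _) = e∉X e∈X
  ∁∪∁⊆∁∩ (inj₂ e∉Y) (_ , e∈Y) = e∉Y e∈Y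

  ∁∪⊆∁∩∁ : ∀ {X Y : Subset E} → ∁ (X ∪ Y) ⊆ ∁ X ∩ ∁ Y
  ∁∪⊆∁∩∁ e∉X∪Y = (λ e∈X → e∉X∪Y (inj₁ e∈X)) , (λ e∈Y → e∉X∪Y (inj₂ e∈Y))

  ∁∩∁⊆∁∪ : ∀ {X Y : Subset E} → ∁ X ∩ ∁ Y ⊆ ∁ (X ∪ Y)
  ∁∩∁⊆∁∪ (e∉X , _) (inj₁ e∈X) = e∉X e∈X
  ∁∩∁⊆∁∪ (_ , e∉Y) (inj₂ e∈Y) = e∉Y e∈Y

  all-filter-∩ : ∀ {P Q : Subset E} {xs} → All Q xs → All (P ∩ Q) (filter (dec P) xs)
  all-filter-∩ {P} {xs = xs} qs = All.zip (All.all-filter (dec P) xs , All.filter⁺ (dec P) qs)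

  length-filter-∁ : ∀ P xs → length (filter (dec P) xs) + length (filter (dec (∁ P)) xs) ≡ length xs
  length-filter-∁ P [] = refl
  length-filter-∁ P (x ∷ xs) with em {P = P x} | em {P = ¬ P x}
  ... | yes p  | yes ¬p  = contradiction p ¬p
  ... | yes _  | no _    = cong suc (length-filter-∁ P xs)
  ... | no _   | yes _   = trans (+-suc _ _) (cong suc (length-filter-∁ P xs))
  ... | no ¬p  | no ¬¬p  = contradiction ¬p ¬¬p

  length-filter-∪∩ : ∀ P Q xs →
    length (filter (dec P) xs) + length (filter (dec Q) xs) ≡
    length (filter (dec (P ∪ Q)) xs) + length (filter (dec (P ∩ Q)) xs)
  length-filter-∪∩ P Q [] = refl
  length-filter-∪∩ P Q (x ∷ xs) with em {P = P x} | em {P = Q x}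
  ... | yes p | yes q
    rewrite filter-accept (dec (P ∪ Q)) {xs = xs} (inj₁ p) | filter-accept (dec (P ∩ Q)) {xs = xs} (p , q)
    = trans (cong suc (+-suc _ _)) (trans (cong (suc ∘ suc) (length-filter-∪∩ P Q xs)) (cong suc (sym (+-suc _ _))))
  ... | yes p | no ¬q
    rewrite filter-accept (dec (P ∪ Q)) {xs = xs} (inj₁ p) | filter-reject (dec (P ∩ Q)) {xs = xs} (¬q ∘ proj₂)
    = cong suc (length-filter-∪∩ P Q xs)
  ... | no ¬p | yes q
    rewrite filter-accept (dec (P ∪ Q)) {xs = xs} (inj₂ q) | filter-reject (dec (P ∩ Q)) {xs = xs} (¬p ∘ proj₁)
    = trans (+-suc _ _) (cong suc (length-filter-∪∩ P Q xs))
  ... | no ¬p | no ¬q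
    rewrite filter-reject (dec (P ∪ Q)) {xs = xs} [ ¬p , ¬q ] | filter-reject (dec (P ∩ Q)) {xs = xs} (¬p ∘ proj₁)
    = length-filter-∪∩ P Q xs

  length-filter-mono : ∀ {P Q : Subset E} → P ⊆ Q → ∀ xs → length (filter (dec P) xs) ≤ length (filter (dec Q) xs)
  length-filter-mono P⊆Q [] = z≤n
  length-filter-mono {P} {Q} P⊆Q (x ∷ xs) with em {P = P x} | em {P = Q x}
  ... | yes _  | yes _  = s≤s (length-filter-mono P⊆Q xs)
  ... | yes p  | no ¬q  = contradiction (P⊆Q p) ¬q
  ... | no _   | yes _  = m≤n⇒m≤1+n (length-filter-mono P⊆Q xs)
  ... | no _   | no _   = length-filter-mono P⊆Q xs

  length-filter-disjoint : ∀ {P Q R : Subset E} xs → All (λ x → x ∈ P → x ∉ Q) xs → P ∪ Q ⊆ R →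
    length (filter (dec P) xs) + length (filter (dec Q) xs) ≤ length (filter (dec R) xs)
  length-filter-disjoint {P} {Q} {R} xs disjoint P∪Q⊆R = begin
    length (filter (dec P) xs) + length (filter (dec Q) xs)              ≡⟨ length-filter-∪∩ P Q xs ⟩
    length (filter (dec (P ∪ Q)) xs) + length (filter (dec (P ∩ Q)) xs)  ≡⟨ cong (λ ys → length (filter (dec (P ∪ Q)) xs) + length ys) P∩Q-none ⟩
    length (filter (dec (P ∪ Q)) xs) + 0                                 ≡⟨ +-identityʳ _ ⟩
    length (filter (dec (P ∪ Q)) xs)                                     ≤⟨ length-filter-mono P∪Q⊆R xs ⟩
    length (filter (dec R) xs)                                           ∎
    where
    open ≤-Reasoning
    P∩Q-none : filter (dec (P ∩ Q)) xs ≡ []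
    P∩Q-none = filter-none (dec (P ∩ Q)) (All.map (λ p⇒¬q (p , q) → p⇒¬q p q) disjoint)

  AtMost : ℕ → Subset E → Set
  AtMost n S = ∀ xs → Unique xs → All S xs → length xs ≤ n

  atMost-⊆ : ∀ {n} {S T : Subset E} → S ⊆ T → AtMost n T → AtMost n S
  atMost-⊆ S⊆T bound xs u xs⊆S = bound xs u (All.map S⊆T xs⊆S)

  atMost-weaken : ∀ {m n} {S : Subset E} → m ≤ n → AtMost m S → AtMost n S
  atMost-weaken m≤n bound xs u xs⊆S = ≤-trans (bound xs u xs⊆S) m≤n

  pigeonhole : ∀ ys → AtMost (length ys) (_∈L ys)
  pigeonhole ys [] _ _ = z≤n
  pigeonhole ys (x ∷ xs) (x∉xs ∷ u) (x∈ys ∷ xs⊆ys) = begin-strict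
    length xs                     ≤⟨ pigeonhole ys′ xs u (All.zipWith (λ (y∈ys , x≢y) → ∈-filter⁺ (dec (x ≢_)) y∈ys x≢y) (xs⊆ys , x∉xs)) ⟩
    length ys′                    <⟨ filter-notAll (dec (x ≢_)) ys (Any.map (λ x≡y x≢y → x≢y x≡y) x∈ys) ⟩
    length ys                     ∎
    where
    open ≤-Reasoning
    ys′ = filter (dec (x ≢_)) ys

  atMost-｛｝ : ∀ x → AtMost 1 ｛ x ｝
  atMost-｛｝ x = atMost-⊆ (λ { refl → here refl }) (pigeonhole (x ∷ []))

  atMost-∪ : ∀ {m n} {S T : Subset E} → AtMost m S → AtMost n T → AtMost (m + n) (S ∪ T)
  atMost-∪ {S = S} {T} bS bT xs u xs⊆S∪T = begin
    length xs                                                         ≡⟨ sym (length-filter-∁ S xs) ⟩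
    length (filter (dec S) xs) + length (filter (dec (∁ S)) xs)       ≤⟨ +-mono-≤ inS inT ⟩
    _                                                                 ∎
    where
    open ≤-Reasoning
    inS = bS _ (Unique.filter⁺ (dec S) u) (All.all-filter (dec S) xs)
    inT = bT _ (Unique.filter⁺ (dec (∁ S)) u)
             (All.map (λ { (¬s , inj₁ s) → contradiction s ¬s ; (_ , inj₂ t) → t }) (all-filter-∩ xs⊆S∪T))

  atMost-∪-lists : ∀ {n} {S T : Subset E} {xs ys} → AtMost n (S ∪ T) → (∀ {x} → x ∈ S → x ∉ T) →
    Unique xs → Unique ys → All S xs → All T ys → length xs + length ys ≤ n
  atMost-∪-lists {xs = xs} {ys} bound S∩T=∅ uxs uys xs⊆S ys⊆T =
    subst (_≤ _) (length-++ xs)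
      (bound (xs ++ ys) (Unique.++⁺ uxs uys λ (x∈xs , x∈ys) → S∩T=∅ (All.lookup xs⊆S x∈xs) (All.lookup ys⊆T x∈ys))
                        (All.++⁺ (All.map inj₁ xs⊆S) (All.map inj₂ ys⊆T)))

  split-excess : ∀ {Z B B′ K L} → B ⊆ Z → B′ ⊆ ∁ Z → All ((B ∪ B′) ∖ K) L →
    All (B ∖ K) (filter (dec Z) L) × All (B′ ∖ K) (filter (dec (∁ Z)) L)
  split-excess {Z} {B} {B′} {K} {L} B⊆Z B′⊆∁Z L⊆ = All.map inZ (all-filter-∩ L⊆) , All.map out (all-filter-∩ L⊆)
    where
    inZ : Z ∩ ((B ∪ B′) ∖ K) ⊆ B ∖ K
    inZ (_ , inj₁ e∈B , e∉K) = e∈B , e∉K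
    inZ (e∈Z , inj₂ e∈B′ , _) = contradiction e∈Z (B′⊆∁Z e∈B′)
    out : ∁ Z ∩ ((B ∪ B′) ∖ K) ⊆ B′ ∖ K
    out (e∉Z , inj₁ e∈B , _) = contradiction (B⊆Z e∈B) e∉Z
    out (_ , inj₂ e∈B′ , e∉K) = e∈B′ , e∉K

  record Enumeration (S : Subset E) : Set where
    field
      list     : List E
      unique   : Unique list
      sound    : All S list
      complete : S ⊆ (_∈L list)

  private
    enumerate-or-grow : ∀ (S : Subset E) k →
      (Σ (List E) λ xs → Unique xs × All S xs × length xs ≡ k) ⊎ Enumeration S
    enumerate-or-grow S zero = inj₁ ([] , [] , [] , refl)
    enumerate-or-grow S (suc k) with enumerate-or-grow S k
    ... | inj₂ enum = inj₂ enum
    ... | inj₁ (xs , u , xs⊆S , refl) with em {P = Σ E λ x → x ∈ S × x ∉L xs}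
    ... | yes (x , x∈S , x∉xs) = inj₁ (x ∷ xs , All.¬Any⇒All¬ xs x∉xs ∷ u , x∈S ∷ xs⊆S , refl)
    ... | no ¬new = inj₂ record
      { list = xs ; unique = u ; sound = xs⊆S ; complete = λ {x} x∈S → dne (λ x∉xs → ¬new (x , x∈S , x∉xs)) }

  atMost⇒enumeration : ∀ {n} {S : Subset E} → AtMost n S → Enumeration S
  atMost⇒enumeration {n} {S} bound with enumerate-or-grow S (suc n)
  ... | inj₁ (xs , u , xs⊆S , |xs|≡1+n) = contradiction (subst (_≤ n) |xs|≡1+n (bound xs u xs⊆S)) 1+n≰n
  ... | inj₂ enum = enum

module Exchange (em : ∀ {ℓ} → ExcludedMiddle ℓ) {E : Set} (M : Matroid E) where
  open Counting em {E}

  IsBase : Subset E → Set₁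
  IsBase = Maximal (Ind M)

  basis-extension : ∀ X {I} → Ind M I → I ⊆ X → Σ (Subset E) λ B → IsBasisOf M X B × I ⊆ B
  basis-extension X {I} iI I⊆X with IM M I X iI I⊆X
  ... | B , (iB , I⊆B , B⊆X) , maxB =
    B , ((iB , B⊆X) , λ B′ (iB′ , B′⊆X) B⊆B′ → maxB B′ (iB′ , (λ i → B⊆B′ (I⊆B i)) , B′⊆X) B⊆B′) , I⊆B

  base-extension : ∀ {I} → Ind M I → Σ (Subset E) λ K → IsBase K × I ⊆ K
  base-extension iI with basis-extension U iI _
  ... | K , ((iK , _) , maxK) , I⊆K = K , (iK , λ K′ iK′ → maxK K′ (iK′ , _)) , I⊆K

  base-extension-within : ∀ {I K} → Ind M I → IsBase K →
    Σ (Subset E) λ K′ → IsBase K′ × I ⊆ K′ × K′ ⊆ I ∪ K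
  base-extension-within {I} {K} iI bK with IM M I (I ∪ K) iI inj₁
  ... | J , (iJ , I⊆J , J⊆I∪K) , maxJ with em {P = IsBase J}
  ... | yes bJ = J , bJ , I⊆J , J⊆I∪K
  ... | no ¬bJ with I3 M J K iJ ¬bJ bK
  ... | x , x∈K , x∉J , iJ+x = contradiction (maxJ (J ∪ ｛ x ｝) (iJ+x , (λ i → inj₁ (I⊆J i)) , J+x⊆I∪K) inj₁ (inj₂ refl)) x∉J
    where
    J+x⊆I∪K : J ∪ ｛ x ｝ ⊆ I ∪ K
    J+x⊆I∪K (inj₁ j) = J⊆I∪K j
    J+x⊆I∪K (inj₂ refl) = inj₂ x∈K

  base-exchange : ∀ {K g y} → IsBase K → y ∉ K → Ind M ((K ∖ ｛ g ｝) ∪ ｛ y ｝) → IsBase ((K ∖ ｛ g ｝) ∪ ｛ y ｝)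
  base-exchange {K} {g} {y} bK y∉K iK′ with em {P = IsBase ((K ∖ ｛ g ｝) ∪ ｛ y ｝)}
  ... | yes bK′ = bK′
  ... | no ¬bK′ with I3 M _ K iK′ ¬bK′ bK
  ... | z , z∈K , z∉K′ , iK′+z = contradiction (proj₂ bK (K ∪ ｛ y ｝) (I2 M _ _ iK′+z K+y⊆K′+z) inj₁ (inj₂ refl)) y∉K
    where
    g≡z : g ≡ z
    g≡z = dne (λ g≢z → z∉K′ (inj₁ (z∈K , g≢z)))
    K+y⊆K′+z : K ∪ ｛ y ｝ ⊆ ((K ∖ ｛ g ｝) ∪ ｛ y ｝) ∪ ｛ z ｝
    K+y⊆K′+z {e} (inj₁ e∈K) with em {P = g ≡ e}
    ... | yes g≡e = inj₂ (trans (sym g≡z) g≡e)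
    ... | no g≢e = inj₁ (inj₁ (e∈K , g≢e))
    K+y⊆K′+z (inj₂ y≡e) = inj₁ (inj₂ y≡e)

  base-difference-bound : ∀ G {K₁ K₂} → IsBase K₁ → IsBase K₂ → K₁ ∖ K₂ ⊆ (_∈L G) → AtMost (length G) (K₂ ∖ K₁)
  base-difference-bound [] {K₁} {K₂} bK₁ bK₂ K₁∖K₂⊆[] = atMost-⊆ K₂∖K₁⊆[] (pigeonhole [])
    where
    K₂∖K₁⊆[] : K₂ ∖ K₁ ⊆ (_∈L [])
    K₂∖K₁⊆[] (e∈K₂ , e∉K₁) =
      contradiction (proj₂ bK₁ K₂ (proj₁ bK₂) (λ k → dne (λ k∉K₂ → case K₁∖K₂⊆[] (k , k∉K₂) of λ ())) e∈K₂) e∉K₁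
  base-difference-bound (g ∷ G) {K₁} {K₂} bK₁ bK₂ K₁∖K₂⊆g∷G with em {P = g ∈ K₁ ∖ K₂}
  ... | no g∉K₁∖K₂ = atMost-weaken (n≤1+n _) (base-difference-bound G bK₁ bK₂ K₁∖K₂⊆G)
    where
    K₁∖K₂⊆G : K₁ ∖ K₂ ⊆ (_∈L G)
    K₁∖K₂⊆G e∈K₁∖K₂ with K₁∖K₂⊆g∷G e∈K₁∖K₂
    ... | here refl = contradiction e∈K₁∖K₂ g∉K₁∖K₂
    ... | there e∈G = e∈G
  ... | yes (g∈K₁ , g∉K₂)
    with I3 M (K₁ ∖ ｛ g ｝) K₂ (I2 M _ _ (proj₁ bK₁) proj₁) (λ b → proj₂ (proj₂ b K₁ (proj₁ bK₁) proj₁ g∈K₁) refl) bK₂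
  ... | y , y∈K₂ , y∉K₁-g , iK₁′ = atMost-⊆ K₂∖K₁⊆y+K₂∖K₁′ (atMost-∪ (atMost-｛｝ y) (base-difference-bound G bK₁′ bK₂ K₁′∖K₂⊆G))
    where
    K₁′ = (K₁ ∖ ｛ g ｝) ∪ ｛ y ｝
    y∉K₁ : y ∉ K₁
    y∉K₁ y∈K₁ = y∉K₁-g (y∈K₁ , λ { refl → g∉K₂ y∈K₂ })
    bK₁′ : IsBase K₁′
    bK₁′ = base-exchange bK₁ y∉K₁ iK₁′
    K₁′∖K₂⊆G : K₁′ ∖ K₂ ⊆ (_∈L G)
    K₁′∖K₂⊆G (inj₁ (e∈K₁ , g≢e) , e∉K₂) with K₁∖K₂⊆g∷G (e∈K₁ , e∉K₂)
    ... | here refl = contradiction refl g≢e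
    ... | there e∈G = e∈G
    K₁′∖K₂⊆G (inj₂ refl , y∉K₂) = contradiction y∈K₂ y∉K₂
    K₂∖K₁⊆y+K₂∖K₁′ : K₂ ∖ K₁ ⊆ ｛ y ｝ ∪ (K₂ ∖ K₁′)
    K₂∖K₁⊆y+K₂∖K₁′ {e} (e∈K₂ , e∉K₁) with em {P = y ≡ e}
    ... | yes y≡e = inj₁ y≡e
    ... | no y≢e = inj₂ (e∈K₂ , λ { (inj₁ (e∈K₁ , _)) → e∉K₁ e∈K₁ ; (inj₂ y≡e) → y≢e y≡e })

  augmentation-bound : ∀ G {J₁ J₂} → Ind M J₁ → Ind M J₂ → J₁ ∖ J₂ ⊆ (_∈L G) →
    (∀ {x} → x ∈ J₂ ∖ J₁ → ¬ Ind M (J₁ ∪ ｛ x ｝)) → AtMost (length G) (J₂ ∖ J₁)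
  augmentation-bound G {J₁} {J₂} iJ₁ iJ₂ J₁∖J₂⊆G unaugmentable with base-extension iJ₂
  ... | K₂ , bK₂ , J₂⊆K₂ with base-extension-within iJ₁ bK₂
  ... | K₁ , bK₁ , J₁⊆K₁ , K₁⊆J₁∪K₂ = atMost-⊆ J₂∖J₁⊆K₂∖K₁ (base-difference-bound G bK₁ bK₂ K₁∖K₂⊆G)
    where
    K₁∖K₂⊆G : K₁ ∖ K₂ ⊆ (_∈L G)
    K₁∖K₂⊆G (e∈K₁ , e∉K₂) with K₁⊆J₁∪K₂ e∈K₁
    ... | inj₁ e∈J₁ = J₁∖J₂⊆G (e∈J₁ , λ e∈J₂ → e∉K₂ (J₂⊆K₂ e∈J₂))
    ... | inj₂ e∈K₂ = contradiction e∈K₂ e∉K₂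
    J₂∖J₁⊆K₂∖K₁ : J₂ ∖ J₁ ⊆ K₂ ∖ K₁
    J₂∖J₁⊆K₂∖K₁ {x} x∈J₂∖J₁ = J₂⊆K₂ (proj₁ x∈J₂∖J₁) , λ x∈K₁ → unaugmentable x∈J₂∖J₁ (I2 M _ _ (proj₁ bK₁) (J₁+x⊆K₁ x∈K₁))
      where
      J₁+x⊆K₁ : x ∈ K₁ → J₁ ∪ ｛ x ｝ ⊆ K₁
      J₁+x⊆K₁ _ (inj₁ e∈J₁) = J₁⊆K₁ e∈J₁
      J₁+x⊆K₁ x∈K₁ (inj₂ refl) = x∈K₁

  -- Extend T ∖ F to a base K′ ⊆ (T ∖ F) ∪ K: then T ∖ K ⊆ (K′ ∖ K) ∪ (F ∖ K), and K′ ∖ K is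
  -- bounded by exchange against K ∖ K′ ⊆ (F ∩ K) ∪ G.
  excess-bound : ∀ F G {T K} → IsBase K → Ind M (T ∖ (_∈L F)) → K ∖ T ⊆ (_∈L G) →
    AtMost (length F + length G) (T ∖ K)
  excess-bound F G {T} {K} bK iT∖F K∖T⊆G with base-extension-within iT∖F bK
  ... | K′ , bK′ , T∖F⊆K′ , K′⊆T∖F∪K =
    atMost-weaken (≤-reflexive count) (atMost-⊆ T∖K⊆K′∖K∪F∖K (atMost-∪ K′∖K-bound F∖K-bound))
    where
    F∩K = filter (dec K) F
    F∖K = filter (dec (∁ K)) F
    K∖K′⊆F∩K++G : K ∖ K′ ⊆ (_∈L F∩K ++ G)
    K∖K′⊆F∩K++G {e} (e∈K , e∉K′) with em {P = e ∈ T}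
    ... | yes e∈T = ∈-++⁺ˡ (∈-filter⁺ (dec K) (dne (λ e∉F → e∉K′ (T∖F⊆K′ (e∈T , e∉F)))) e∈K)
    ... | no e∉T = ∈-++⁺ʳ F∩K (K∖T⊆G (e∈K , e∉T))
    K′∖K-bound : AtMost (length (F∩K ++ G)) (K′ ∖ K)
    K′∖K-bound = base-difference-bound (F∩K ++ G) bK bK′ K∖K′⊆F∩K++G
    F∖K-bound : AtMost (length F∖K) ((_∈L F) ∖ K)
    F∖K-bound = atMost-⊆ (λ (e∈F , e∉K) → ∈-filter⁺ (dec (∁ K)) e∈F e∉K) (pigeonhole F∖K)
    T∖K⊆K′∖K∪F∖K : T ∖ K ⊆ (K′ ∖ K) ∪ ((_∈L F) ∖ K)
    T∖K⊆K′∖K∪F∖K {e} (e∈T , e∉K) with em {P = e ∈ K′}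
    ... | yes e∈K′ = inj₁ (e∈K′ , e∉K)
    ... | no e∉K′ = inj₂ (dne (λ e∉F → e∉K′ (T∖F⊆K′ (e∈T , e∉F))) , e∉K)
    count : length (F∩K ++ G) + length F∖K ≡ length F + length G
    count = begin
      length (F∩K ++ G) + length F∖K        ≡⟨ cong (_+ length F∖K) (length-++ F∩K) ⟩
      length F∩K + length G + length F∖K    ≡⟨ +-assoc (length F∩K) _ _ ⟩
      length F∩K + (length G + length F∖K)  ≡⟨ cong (length F∩K +_) (+-comm (length G) _) ⟩
      length F∩K + (length F∖K + length G)  ≡⟨ +-assoc (length F∩K) _ _ ⟨
      length F∩K + length F∖K + length G    ≡⟨ cong (_+ length G) (length-filter-∁ K F) ⟩
      length F + length G                   ∎
      where open ≡-Reasoning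

  extension-within-union : ∀ G {V U} → Ind M V → Ind M U → V ∖ U ⊆ (_∈L G) →
    Σ (Subset E) λ W → Ind M W × V ⊆ W × W ⊆ V ∪ U × AtMost (length G) (U ∖ W)
  extension-within-union G {V} {U} iV iU V∖U⊆G with IM M V (V ∪ U) iV inj₁
  ... | W , (iW , V⊆W , W⊆V∪U) , maxW = W , iW , V⊆W , W⊆V∪U , augmentation-bound G iW iU W∖U⊆G unaugmentable
    where
    W∖U⊆G : W ∖ U ⊆ (_∈L G)
    W∖U⊆G (e∈W , e∉U) with W⊆V∪U e∈W
    ... | inj₁ e∈V = V∖U⊆G (e∈V , e∉U)
    ... | inj₂ e∈U = contradiction e∈U e∉U
    unaugmentable : ∀ {x} → x ∈ U ∖ W → ¬ Ind M (W ∪ ｛ x ｝)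
    unaugmentable {x} (x∈U , x∉W) iW+x = x∉W (maxW (W ∪ ｛ x ｝) (iW+x , (λ v → inj₁ (V⊆W v)) , W+x⊆V∪U) inj₁ (inj₂ refl))
      where
      W+x⊆V∪U : W ∪ ｛ x ｝ ⊆ V ∪ U
      W+x⊆V∪U (inj₁ e∈W) = W⊆V∪U e∈W
      W+x⊆V∪U (inj₂ refl) = inj₂ x∈U

  independent-∪-list : ∀ {B S K : Subset E} {L : List E} → Ind M B → S ⊆ B → All (B ∖ K) L → Ind M (S ∪ (_∈L L))
  independent-∪-list {B} {S} {L = L} iB S⊆B L⊆B∖K = 
    I2 M (S ∪ (_∈L L)) B iB λ { (inj₁ e∈S) → S⊆B e∈S ; (inj₂ e∈L) → proj₁ (All.lookup L⊆B∖K e∈L) }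

cancel-deficits : ∀ n₁ n₂ na nb ga₁ gb₁ ga₂ gb₂ la₁ lb₁ la₂ lb₂ →
  n₁ + ga₁ + gb₁ ≤ la₁ + lb₁ → n₂ + ga₂ + gb₂ ≤ la₂ + lb₂ →
  la₁ + la₂ ≤ na + (ga₁ + ga₂) → lb₁ + lb₂ ≤ nb + (gb₁ + gb₂) → n₁ + n₂ ≤ na + nb
cancel-deficits n₁ n₂ na nb ga₁ gb₁ ga₂ gb₂ la₁ lb₁ la₂ lb₂ balance₁ balance₂ boundA boundB =
  +-cancelˡ-≤ g _ _ (begin
    g + (n₁ + n₂)                                     ≡⟨ solve 6 (λ n₁ n₂ ga₁ gb₁ ga₂ gb₂ →
                                                           (ga₁ :+ ga₂ :+ (gb₁ :+ gb₂)) :+ (n₁ :+ n₂) :=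
                                                           (n₁ :+ ga₁ :+ gb₁) :+ (n₂ :+ ga₂ :+ gb₂)) refl n₁ n₂ ga₁ gb₁ ga₂ gb₂ ⟩
    (n₁ + ga₁ + gb₁) + (n₂ + ga₂ + gb₂)               ≤⟨ +-mono-≤ balance₁ balance₂ ⟩
    (la₁ + lb₁) + (la₂ + lb₂)                         ≡⟨ interchange la₁ lb₁ la₂ lb₂ ⟩
    (la₁ + la₂) + (lb₁ + lb₂)                         ≤⟨ +-mono-≤ boundA boundB ⟩
    (na + (ga₁ + ga₂)) + (nb + (gb₁ + gb₂))           ≡⟨ solve 6 (λ na nb ga₁ gb₁ ga₂ gb₂ →
                                                           (na :+ (ga₁ :+ ga₂)) :+ (nb :+ (gb₁ :+ gb₂)) :=
                                                           (ga₁ :+ ga₂ :+ (gb₁ :+ gb₂)) :+ (na :+ nb)) refl na nb ga₁ gb₁ ga₂ gb₂ ⟩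
    g + (na + nb)                                     ∎)
  where
  open ≤-Reasoning
  open +-*-Solver using (solve; _:+_; _:=_)
  g = ga₁ + ga₂ + (gb₁ + gb₂)

module Connectivity (em : ∀ {ℓ} → ExcludedMiddle ℓ) {E : Set} (M : Matroid E) where
  open Counting em {E}
  open Exchange em M
  open +-*-Solver using (solve; _:+_; _:=_)

  del-≤-witness : ∀ {I J v m} → DelIs M I J v → DelWitness M I J m → v ≤∞ fin m
  del-≤-witness {v = ∞} {m} no-witness witness = ⊥-elim (no-witness m witness)
  del-≤-witness {v = fin n} {m} (_ , minimal) witness with n ≤? m
  ... | yes n≤m = n≤m
  ... | no n≰m = ⊥-elim (minimal m (≰⇒> n≰m) witness)

  enumeration⇒del-witness : ∀ {I J K} → IsBase K → (F : Enumeration ((I ∪ J) ∖ K)) →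
    DelWitness M I J (length (Enumeration.list F))
  enumeration⇒del-witness {K = K} bK F =
    list , refl , unique , All.map proj₁ sound , I2 M _ K (proj₁ bK) (λ (e∈I∪J , e∉F) → dne (λ e∉K → e∉F (complete (e∈I∪J , e∉K))))
    where open Enumeration F

  kappa-bound : ∀ {Z n K I I′} G G′ → KappaIs M Z (fin n) → IsBase K →
    Ind M I → I ⊆ Z → Ind M I′ → I′ ⊆ ∁ Z →
    (K ∩ Z) ∖ I ⊆ (_∈L G) → (K ∖ Z) ∖ I′ ⊆ (_∈L G′) →
    AtMost (n + (length G + length G′)) ((I ∖ K) ∪ (I′ ∖ K))
  kappa-bound {Z} {n} {K} {I} {I′} G G′ κZ bK iI I⊆Z iI′ I′⊆∁Z K∩Z∖I⊆G K∖Z∖I′⊆G′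
    with basis-extension Z iI I⊆Z | basis-extension (∁ Z) iI′ I′⊆∁Z
  ... | B , basis-B , I⊆B | B′ , basis-B′ , I′⊆B′ with κZ B B′ basis-B basis-B′
  ... | (F , |F|≡n , _ , _ , iB∪B′∖F) , _ =
    subst (λ m → AtMost m ((I ∖ K) ∪ (I′ ∖ K))) (cong₂ _+_ |F|≡n (length-++ G))
      (atMost-⊆ excess⊆ (excess-bound F (G ++ G′) bK iB∪B′∖F K∖B∪B′⊆G++G′))
    where
    excess⊆ : (I ∖ K) ∪ (I′ ∖ K) ⊆ (B ∪ B′) ∖ K
    excess⊆ (inj₁ (e∈I , e∉K)) = inj₁ (I⊆B e∈I) , e∉K
    excess⊆ (inj₂ (e∈I′ , e∉K)) = inj₂ (I′⊆B′ e∈I′) , e∉K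
    K∖B∪B′⊆G++G′ : K ∖ (B ∪ B′) ⊆ (_∈L G ++ G′)
    K∖B∪B′⊆G++G′ {e} (e∈K , e∉B∪B′) with em {P = e ∈ Z}
    ... | yes e∈Z = ∈-++⁺ˡ (K∩Z∖I⊆G ((e∈K , e∈Z) , λ e∈I → e∉B∪B′ (inj₁ (I⊆B e∈I))))
    ... | no e∉Z = ∈-++⁺ʳ G (K∖Z∖I′⊆G′ ((e∈K , e∉Z) , λ e∈I′ → e∉B∪B′ (inj₂ (I′⊆B′ e∈I′))))

  record Uncrossing (K A B : Subset E) (n : ℕ) : Set₁ where
    field
      IA IB             : Subset E
      indA              : Ind M IA
      indB              : Ind M IB
      IA⊆A              : IA ⊆ A
      IB⊆B              : IB ⊆ B
      excessA excessB   : List E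
      uniqueA           : Unique excessA
      uniqueB           : Unique excessB
      excessA⊆          : All (IA ∖ K) excessA
      excessB⊆          : All (IB ∖ K) excessB
      deficitA deficitB : List E
      deficitA⊇         : (K ∩ A) ∖ IA ⊆ (_∈L deficitA)
      deficitB⊇         : (K ∩ B) ∖ IB ⊆ (_∈L deficitB)
      balance           : n + length deficitA + length deficitB ≤ length excessA + length excessB

  module Uncross {K A B : Subset E} (J₁ J₂ : List E) (uJ₁ : Unique J₁) (uJ₂ : Unique J₂)
    (J₁⊆ : All ((A ∪ B) ∖ K) J₁) (J₂⊆ : All ((A ∩ B) ∖ K) J₂)
    (iS∪ : Ind M ((K ∩ (A ∪ B)) ∪ (_∈L J₁))) (iS∩ : Ind M ((K ∩ (A ∩ B)) ∪ (_∈L J₂))) where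

    S∪ S∩ : Subset E
    S∪ = (K ∩ (A ∪ B)) ∪ (_∈L J₁)
    S∩ = (K ∩ (A ∩ B)) ∪ (_∈L J₂)

    H : List E
    H = filter (dec (∁ S∪)) J₂

    S∩∖S∪⊆H : S∩ ∖ S∪ ⊆ (_∈L H)
    S∩∖S∪⊆H (inj₁ (e∈K , e∈A , _) , e∉S∪) = contradiction (inj₁ (e∈K , inj₁ e∈A)) e∉S∪
    S∩∖S∪⊆H (inj₂ e∈J₂ , e∉S∪) = ∈-filter⁺ (dec (∁ S∪)) e∈J₂ e∉S∪

    -- W ⊇ S∩ is maximal inside S∩ ∪ S∪, so it misses at most |H| elements of S∪; D lists W ∖ K.
    extension = extension-within-union H iS∩ iS∪ S∩∖S∪⊆H
    W = proj₁ extension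
    iW : Ind M W
    iW = proj₁ (proj₂ extension)
    S∩⊆W : S∩ ⊆ W
    S∩⊆W = proj₁ (proj₂ (proj₂ extension))
    S∪∖W-bound : AtMost (length H) (S∪ ∖ W)
    S∪∖W-bound = proj₂ (proj₂ (proj₂ (proj₂ extension)))

    module N = Enumeration (atMost⇒enumeration S∪∖W-bound)

    D : List E
    D = filter (dec W) J₁ ++ H

    D-unique : Unique D
    D-unique = Unique.++⁺ (Unique.filter⁺ (dec W) uJ₁) (Unique.filter⁺ (dec (∁ S∪)) uJ₂)
      λ (e∈J₁∩W , e∈H) → proj₂ (∈-filter⁻ (dec (∁ S∪)) {xs = J₂} e∈H) (inj₂ (proj₁ (∈-filter⁻ (dec W) {xs = J₁} e∈J₁∩W)))

    D⊆W∖K : ∀ {e} → e ∈L D → e ∈ W × e ∉ K × e ∈ A ∪ B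
    D⊆W∖K {e} e∈D with ∈-++⁻ (filter (dec W) J₁) e∈D
    ... | inj₁ e∈J₁∩W = let (e∈J₁ , e∈W) = ∈-filter⁻ (dec W) {xs = J₁} e∈J₁∩W ; (e∈A∪B , e∉K) = All.lookup J₁⊆ e∈J₁
                        in e∈W , e∉K , e∈A∪B
    ... | inj₂ e∈H = let e∈J₂ = proj₁ (∈-filter⁻ (dec (∁ S∪)) {xs = J₂} e∈H) ; ((e∈A , _) , e∉K) = All.lookup J₂⊆ e∈J₂
                     in S∩⊆W (inj₂ e∈J₂) , e∉K , inj₁ e∈A

    J₂⊆D : ∀ {e} → e ∈L J₂ → e ∈L D
    J₂⊆D {e} e∈J₂ with em {P = e ∈ S∪}
    ... | yes (inj₁ (e∈K , _)) = contradiction e∈K (proj₂ (All.lookup J₂⊆ e∈J₂))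
    ... | yes (inj₂ e∈J₁) = ∈-++⁺ˡ (∈-filter⁺ (dec W) e∈J₁ (S∩⊆W (inj₂ e∈J₂)))
    ... | no e∉S∪ = ∈-++⁺ʳ _ (∈-filter⁺ (dec (∁ S∪)) e∈J₂ e∉S∪)

    D⊆A∪B : All (A ∪ B) D
    D⊆A∪B = All.tabulate (λ e∈D → proj₂ (proj₂ (D⊆W∖K e∈D)))

    excess : (P : Subset E) → List E
    excess P = filter (dec P) D

    excess⊆ : ∀ P → All ((W ∩ P) ∖ K) (excess P)
    excess⊆ P = All.tabulate λ e∈D∩P → let (e∈D , e∈P) = ∈-filter⁻ (dec P) {xs = D} e∈D∩P ; (e∈W , e∉K , _) = D⊆W∖K e∈D
                                       in (e∈W , e∈P) , e∉K

    deficit : (P : Subset E) → List E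
    deficit P = filter (dec (K ∩ P)) N.list

    deficit⊇ : ∀ {P} → P ⊆ A ∪ B → (K ∩ P) ∖ (W ∩ P) ⊆ (_∈L deficit P)
    deficit⊇ {P} P⊆A∪B ((e∈K , e∈P) , e∉W∩P) =
      ∈-filter⁺ (dec (K ∩ P)) (N.complete (inj₁ (e∈K , P⊆A∪B e∈P) , λ e∈W → e∉W∩P (e∈W , e∈P))) (e∈K , e∈P)

    excess-count : length J₂ + length D ≤ length (excess A) + length (excess B)
    excess-count = begin
      length J₂ + length D                                  ≤⟨ +-monoˡ-≤ (length D) J₂-bound ⟩
      length (excess (A ∩ B)) + length D                    ≡⟨ +-comm _ (length D) ⟩
      length D + length (excess (A ∩ B))                    ≡⟨ cong (λ xs → length xs + length (excess (A ∩ B))) (filter-all (dec (A ∪ B)) D⊆A∪B) ⟨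
      length (excess (A ∪ B)) + length (excess (A ∩ B))     ≡⟨ length-filter-∪∩ A B D ⟨
      length (excess A) + length (excess B)                 ∎
      where
      open ≤-Reasoning
      J₂-bound : length J₂ ≤ length (excess (A ∩ B))
      J₂-bound = pigeonhole (excess (A ∩ B)) J₂ uJ₂
        (All.tabulate λ e∈J₂ → ∈-filter⁺ (dec (A ∩ B)) (J₂⊆D e∈J₂) (proj₁ (All.lookup J₂⊆ e∈J₂)))

    J₁∖W : List E
    J₁∖W = filter (dec (∁ W)) J₁

    deficit-count : length (deficit A) + length (deficit B) + length J₁∖W ≤ length H
    deficit-count = begin
      length (deficit A) + length (deficit B) + length J₁∖W                 ≤⟨ +-mono-≤ deficits≤N∩K J₁∖W≤N∖K ⟩
      length (filter (dec K) N.list) + length (filter (dec (∁ K)) N.list)   ≡⟨ length-filter-∁ K N.list ⟩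
      length N.list                                                         ≤⟨ S∪∖W-bound N.list N.unique N.sound ⟩
      length H                                                              ∎
      where
      open ≤-Reasoning
      deficits≤N∩K : length (deficit A) + length (deficit B) ≤ length (filter (dec K) N.list)
      deficits≤N∩K = length-filter-disjoint N.list
        (All.map (λ (_ , e∉W) (e∈K , e∈A) (_ , e∈B) → e∉W (S∩⊆W (inj₁ (e∈K , e∈A , e∈B)))) N.sound)
        [ proj₁ , proj₁ ]
      J₁∖W≤N∖K : length J₁∖W ≤ length (filter (dec (∁ K)) N.list)
      J₁∖W≤N∖K = pigeonhole _ J₁∖W (Unique.filter⁺ (dec (∁ W)) uJ₁) (All.tabulate λ e∈J₁∖W →
        let (e∈J₁ , e∉W) = ∈-filter⁻ (dec (∁ W)) {xs = J₁} e∈J₁∖W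
        in ∈-filter⁺ (dec (∁ K)) (N.complete (inj₂ e∈J₁ , e∉W)) (proj₂ (All.lookup J₁⊆ e∈J₁)))

    balance : length J₁ + length J₂ + length (deficit A) + length (deficit B) ≤ length (excess A) + length (excess B)
    balance = begin
      length J₁ + length J₂ + dA + dB                         ≡⟨ cong (λ n → n + length J₂ + dA + dB) (length-filter-∁ W J₁) ⟨
      length J₁∩W + length J₁∖W + length J₂ + dA + dB         ≡⟨ rearrange (length J₁∩W) (length J₁∖W) (length J₂) dA dB ⟩
      length J₂ + (length J₁∩W + (dA + dB + length J₁∖W))     ≤⟨ +-monoʳ-≤ (length J₂) (+-monoʳ-≤ (length J₁∩W) deficit-count) ⟩
      length J₂ + (length J₁∩W + length H)                    ≡⟨ cong (length J₂ +_) (length-++ J₁∩W) ⟨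
      length J₂ + length D                                    ≤⟨ excess-count ⟩
      length (excess A) + length (excess B)                   ∎
      where
      open ≤-Reasoning
      J₁∩W = filter (dec W) J₁
      dA = length (deficit A)
      dB = length (deficit B)
      rearrange : ∀ a b c d e → a + b + c + d + e ≡ c + (a + (d + e + b))
      rearrange = solve 5 (λ a b c d e → a :+ b :+ c :+ d :+ e := c :+ (a :+ (d :+ e :+ b))) refl

    result : Uncrossing K A B (length J₁ + length J₂)
    result = record
      { IA = W ∩ A ; IB = W ∩ B
      ; indA = I2 M _ W iW proj₁ ; indB = I2 M _ W iW proj₁
      ; IA⊆A = proj₂ ; IB⊆B = proj₂
      ; excessA = excess A ; excessB = excess B
      ; uniqueA = Unique.filter⁺ (dec A) D-unique ; uniqueB = Unique.filter⁺ (dec B) D-unique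
      ; excessA⊆ = excess⊆ A ; excessB⊆ = excess⊆ B
      ; deficitA = deficit A ; deficitB = deficit B
      ; deficitA⊇ = deficit⊇ inj₁ ; deficitB⊇ = deficit⊇ inj₂
      ; balance = balance
      }

  uncross : ∀ {K A B} J₁ J₂ → Unique J₁ → Unique J₂ → All ((A ∪ B) ∖ K) J₁ → All ((A ∩ B) ∖ K) J₂ →
    Ind M ((K ∩ (A ∪ B)) ∪ (_∈L J₁)) → Ind M ((K ∩ (A ∩ B)) ∪ (_∈L J₂)) →
    Uncrossing K A B (length J₁ + length J₂)
  uncross {K} {A} {B} = Uncross.result {K} {A} {B}

  module FiniteCase {X Y : Subset E} {na nb : ℕ} (κX : KappaIs M X (fin na)) (κY : KappaIs M Y (fin nb)) where

    K : Subset E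
    K = proj₁ (base-extension (I1 M))

    bK : IsBase K
    bK = proj₁ (proj₂ (base-extension (I1 M)))

    module BasisOver (Z : Subset E) where
      private
        extension = basis-extension Z (I2 M (K ∩ Z) K (proj₁ bK) proj₁) proj₂
      B : Subset E
      B = proj₁ extension
      isBasis : IsBasisOf M Z B
      isBasis = proj₁ (proj₂ extension)
      ind : Ind M B
      ind = proj₁ (proj₁ isBasis)
      B⊆Z : B ⊆ Z
      B⊆Z = proj₂ (proj₁ isBasis)
      K∩Z⊆B : K ∩ Z ⊆ B
      K∩Z⊆B = proj₂ (proj₂ extension)

    module B∪ = BasisOver (X ∪ Y)
    module B∪ᶜ = BasisOver (∁ (X ∪ Y))
    module B∩ = BasisOver (X ∩ Y)
    module B∩ᶜ = BasisOver (∁ (X ∩ Y))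

    excess-sum-bound : ∀ Lc Ld → Unique Lc → Unique Ld →
      All ((B∪.B ∪ B∪ᶜ.B) ∖ K) Lc → All ((B∩.B ∪ B∩ᶜ.B) ∖ K) Ld → length Lc + length Ld ≤ na + nb
    excess-sum-bound Lc Ld uc ud Lc⊆ Ld⊆ = begin
      length Lc + length Ld                               ≡⟨ cong₂ _+_ (length-filter-∁ (X ∪ Y) Lc) (length-filter-∁ (X ∩ Y) Ld) ⟨
      (length L₁ + length L₃) + (length L₂ + length L₄)   ≡⟨ interchange (length L₁) (length L₃) (length L₂) (length L₄) ⟩
      (length L₁ + length L₂) + (length L₃ + length L₄)   ≡⟨ cong (length L₁ + length L₂ +_) (+-comm (length L₃) (length L₄)) ⟩
      (length L₁ + length L₂) + (length L₄ + length L₃)   ≤⟨ cancel-deficits _ _ na nb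
                                                              (length R.deficitA) (length R.deficitB) (length Rᶜ.deficitA) (length Rᶜ.deficitB)
                                                              (length R.excessA) (length R.excessB) (length Rᶜ.excessA) (length Rᶜ.excessB)
                                                              R.balance Rᶜ.balance boundX boundY ⟩
      na + nb                                             ∎
      where
      open ≤-Reasoning
      L₁ = filter (dec (X ∪ Y)) Lc
      L₃ = filter (dec (∁ (X ∪ Y))) Lc
      L₂ = filter (dec (X ∩ Y)) Ld
      L₄ = filter (dec (∁ (X ∩ Y))) Ld
      L₁⊆ = proj₁ (split-excess B∪.B⊆Z B∪ᶜ.B⊆Z Lc⊆)
      L₃⊆ = proj₂ (split-excess B∪.B⊆Z B∪ᶜ.B⊆Z Lc⊆)
      L₂⊆ = proj₁ (split-excess B∩.B⊆Z B∩ᶜ.B⊆Z Ld⊆)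
      L₄⊆ = proj₂ (split-excess B∩.B⊆Z B∩ᶜ.B⊆Z Ld⊆)

      module R = Uncrossing (uncross {K} {X} {Y} L₁ L₂
        (Unique.filter⁺ (dec (X ∪ Y)) uc) (Unique.filter⁺ (dec (X ∩ Y)) ud)
        (All.map (λ (e∈B , e∉K) → B∪.B⊆Z e∈B , e∉K) L₁⊆) (All.map (λ (e∈B , e∉K) → B∩.B⊆Z e∈B , e∉K) L₂⊆)
        (independent-∪-list B∪.ind B∪.K∩Z⊆B L₁⊆) (independent-∪-list B∩.ind B∩.K∩Z⊆B L₂⊆))

      module Rᶜ = Uncrossing (uncross {K} {∁ X} {∁ Y} L₄ L₃
        (Unique.filter⁺ (dec (∁ (X ∩ Y))) ud) (Unique.filter⁺ (dec (∁ (X ∪ Y))) uc)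
        (All.map (λ (e∈B , e∉K) → ∁∩⊆∁∪∁ {X} {Y} (B∩ᶜ.B⊆Z e∈B) , e∉K) L₄⊆)
        (All.map (λ (e∈B , e∉K) → ∁∪⊆∁∩∁ {X} {Y} (B∪ᶜ.B⊆Z e∈B) , e∉K) L₃⊆)
        (independent-∪-list B∩ᶜ.ind (λ (e∈K , e∈∁X∪∁Y) → B∩ᶜ.K∩Z⊆B (e∈K , ∁∪∁⊆∁∩ {X} {Y} e∈∁X∪∁Y)) L₄⊆)
        (independent-∪-list B∪ᶜ.ind (λ (e∈K , e∈∁X∩∁Y) → B∪ᶜ.K∩Z⊆B (e∈K , ∁∩∁⊆∁∪ {X} {Y} e∈∁X∩∁Y)) L₃⊆))

      boundX : length R.excessA + length Rᶜ.excessA ≤ na + (length R.deficitA + length Rᶜ.deficitA)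
      boundX = atMost-∪-lists
        (kappa-bound R.deficitA Rᶜ.deficitA κX bK R.indA R.IA⊆A Rᶜ.indA Rᶜ.IA⊆A R.deficitA⊇ Rᶜ.deficitA⊇)
        (λ (e∈I , _) (e∈Iᶜ , _) → Rᶜ.IA⊆A e∈Iᶜ (R.IA⊆A e∈I)) R.uniqueA Rᶜ.uniqueA R.excessA⊆ Rᶜ.excessA⊆

      boundY : length R.excessB + length Rᶜ.excessB ≤ nb + (length R.deficitB + length Rᶜ.deficitB)
      boundY = atMost-∪-lists
        (kappa-bound R.deficitB Rᶜ.deficitB κY bK R.indB R.IB⊆B Rᶜ.indB Rᶜ.IB⊆B R.deficitB⊇ Rᶜ.deficitB⊇)
        (λ (e∈I , _) (e∈Iᶜ , _) → Rᶜ.IB⊆B e∈Iᶜ (R.IB⊆B e∈I)) R.uniqueB Rᶜ.uniqueB R.excessB⊆ Rᶜ.excessB⊆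

    submodular : ∀ {c d} → KappaIs M (X ∪ Y) c → KappaIs M (X ∩ Y) d → (c +∞ d) ≤∞ fin (na + nb)
    submodular κ∪ κ∩ =
      +∞-≤-fin (del-≤-witness (κ∪ B∪.B B∪ᶜ.B B∪.isBasis B∪ᶜ.isBasis) (enumeration⇒del-witness bK G∪))
               (del-≤-witness (κ∩ B∩.B B∩ᶜ.B B∩.isBasis B∩ᶜ.isBasis) (enumeration⇒del-witness bK G∩))
               (excess-sum-bound G∪.list G∩.list G∪.unique G∩.unique G∪.sound G∩.sound)
      where
      G∪ = atMost⇒enumeration λ Lc uc Lc⊆ → subst (_≤ na + nb) (+-identityʳ _) (excess-sum-bound Lc [] uc [] Lc⊆ [])
      G∩ = atMost⇒enumeration λ Ld ud Ld⊆ → excess-sum-bound [] Ld [] ud [] Ld⊆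
      module G∪ = Enumeration G∪
      module G∩ = Enumeration G∩

lemma19 : (∀ {ℓ} → ExcludedMiddle ℓ) →
          {E : Set} (M : Matroid E) (X Y : Subset E) (a b c d : ℕ∞) →
          KappaIs M X a → KappaIs M Y b →
          KappaIs M (X ∪ Y) c → KappaIs M (X ∩ Y) d →
          (c +∞ d) ≤∞ (a +∞ b)
lemma19 em M X Y ∞ b c d _ _ _ _ = ≤∞-∞ (c +∞ d)
lemma19 em M X Y (fin na) ∞ c d _ _ _ _ = ≤∞-∞ (c +∞ d)
lemma19 em M X Y (fin na) (fin nb) c d κX κY κ∪ κ∩ = Connectivity.FiniteCase.submodular em M κX κY κ∪ κ∩
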